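{- Consider a sequence of distributions $(S,\mathbf{w})^{(0)},(S,\mathbf{w})^{(1)},\dots$, where each $(S,\mathbf{w})^{(t+1)}$ arises from $(S,\mathbf{w})^{(t)}$ by changing the weight of a single index, inserting a new index with positive weight, or removing an index. Let $P^{(0)}$ be the output of Construct on $(S,\mathbf{w})^{(0)}$, and for $t\ge 1$ let $P^{(t)}$ be obtained from $P^{(t-1)}$ by the procedure Update. Then $P^{(0)}$ is $1$-suitable for $(S,\mathbf{w})^{(0)}$, and for every $t\ge 0$, $P^{(t)}$ is $2$-suitable for $(S,\mathbf{w})^{(t)}$.
   Context: A distribution $(S,\mathbf{w})$ consists of a finite index set $S$ with $n=|S|$ and positive real weights $w_i$, $i\in S$; $W=\sum_i w_i$ and $\bar w=W/n$. Superscript $(t)$ denotes quantities at step $t$, e.g. $\bar w^{(t)}=W^{(t)}/n^{(t)}$. A proposal array is an array with entries in $S$; $c_i$ denotes the number of occurrences of $i$. A proposal array $P$ is $\alpha$-suitable for $(S,\mathbf{w})$ iff for all $i\in S$: $\frac{1}{\alpha}\frac{w_i}{\bar w}\le c_i\le\left\lceil \alpha\frac{w_i}{\bar w}\right\rceil$. Procedure Construct on $(S,\mathbf{w})$: build an array containing each $i\in S$ exactly $\lceil w_i/\bar w\rceil$ times. Procedure Update: a variable $r$ records the last step at which Construct was called (initially $r=0$). At step $t$, after the change affecting index $i$: if $\bar w^{(t)}<\bar w^{(r)}/2$ or $\bar w^{(t)}>2\bar w^{(r)}$, set $P\gets$ Construct$((S,\mathbf{w})^{(t)})$ and $r\gets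 t$; otherwise set the new target count of $i$ to $\lceil w_i^{(t)}/\bar w^{(r)}\rceil$ if $i\in S^{(t)}$ and $0$ if $i$ was removed, and insert or erase occurrences of $i$ in $P$ until its count equals this target. -}

module Defs where

open import Level using (0ℓ)
open import Data.Nat as ℕ using (ℕ; zero; suc)
open import Data.Integer as ℤ using (ℤ; +_; -[1+_])
open import Data.Product using (Σ; _×_; _,_; proj₁; proj₂; ∃; ∃-syntax)
open import Data.Sum using (_⊎_)
open import Data.Maybe using (Maybe; just; nothing)
open import Data.List using (List; []; _∷_; _++_; map; length; replicate; concatMap)
open import Data.List.Membership.Propositional using (_∈_; _∉_)
open import Data.List.Relation.Unary.All using (All)
open import Data.List.Relation.Unary.Unique.Propositional using (Unique)
open import Data.List.Relation.Binary.Permutation.Propositional using (_↭_)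
open import Relation.Binary.PropositionalEquality using (_≡_; _≢_)
open import Relation.Binary.Structures using (IsStrictTotalOrder)
open import Algebra.Structures using (IsCommutativeRing)
open import Relation.Nullary using (yes; no)

-- The paper's weights are positive reals;
-- ℝ is not available, so we quantify over every ordered field that has a
-- ceiling function (i.e. every Archimedean ordered field, ℝ included).

record OrderedField : Set₁ where
  infixl 6 _+_
  infixl 7 _*_
  infix 4 _<_
  field
    Carrier : Set
    _+_ _*_ : Carrier → Carrier → Carrier
    -_      : Carrier → Carrier
    0# 1#   : Carrier
    _⁻¹     : Carrier → Carrier
    _<_     : Carrier → Carrier → Set
    isCommutativeRing : IsCommutativeRing _≡_ _+_ _*_ -_ 0# 1#
    0≢1        : 0# ≢ 1#
    ⁻¹-inverse : ∀ x → x ≢ 0# → x * (x ⁻¹) ≡ 1#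
    isStrictTotalOrder : IsStrictTotalOrder _≡_ _<_
    +-mono-<   : ∀ {x y} z → x < y → x + z < y + z
    *-pos      : ∀ {x y} → 0# < x → 0# < y → 0# < x * y

  infix 4 _≤_
  _≤_ : Carrier → Carrier → Set
  x ≤ y = x < y ⊎ x ≡ y

  infixl 7 _/_
  _/_ : Carrier → Carrier → Carrier
  x / y = x * (y ⁻¹)

  fromℕ : ℕ → Carrier
  fromℕ zero    = 0#
  fromℕ (suc n) = 1# + fromℕ n

  fromℤ : ℤ → Carrier
  fromℤ (+ n)      = fromℕ n
  fromℤ -[1+ n ]   = - (fromℕ (suc n))

record CeilField : Set₁ where
  field
    orderedField : OrderedField
  open OrderedField orderedField public
  field
    ⌈_⌉       : Carrier → ℤ
    ceil-upper : ∀ x → x ≤ fromℤ ⌈ x ⌉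
    ceil-lower : ∀ x → fromℤ ⌈ x ⌉ < x + 1#

module Model (K : CeilField) where
  open CeilField K public

  -- ceiling as a natural number (used only on positive arguments,
  -- where ⌈ x ⌉ ≥ 1, so this is exactly ⌈ x ⌉)
  ⌈_⌉ℕ : Carrier → ℕ
  ⌈ x ⌉ℕ = ℤ.∣ ⌈ x ⌉ ∣

  record Dist : Set where
    field
      entries  : List (ℕ × Carrier)
      unique   : Unique (map proj₁ entries)
      positive : All (λ e → 0# < proj₂ e) entries
      nonempty : entries ≢ []

  open Dist public

  n : Dist → ℕ
  n D = length (entries D)

  sumW : List (ℕ × Carrier) → Carrier
  sumW []             = 0#
  sumW ((_ , w) ∷ es) = w + sumW es

  W : Dist → Carrier
  W D = sumW (entries D)

  wbar : Dist → Carrier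
  wbar D = W D / fromℕ (n D)

  weightOf : ℕ → List (ℕ × Carrier) → Maybe Carrier
  weightOf i [] = nothing
  weightOf i ((j , w) ∷ es) with j ℕ.≟ i
  ... | yes _ = just w
  ... | no  _ = weightOf i es

  Array : Set
  Array = List ℕ

  count : ℕ → Array → ℕ
  count i [] = 0
  count i (x ∷ xs) with x ℕ.≟ i
  ... | yes _ = suc (count i xs)
  ... | no  _ = count i xs

  Suitable : Carrier → Array → Dist → Set
  Suitable α P D =
    ∀ i w → (i , w) ∈ entries D →
      ((α ⁻¹) * (w / wbar D) ≤ fromℕ (count i P))
      × (count i P ℕ.≤ ⌈ α * (w / wbar D) ⌉ℕ)

  construct : Dist → Array
  construct D = concatMap (λ e → replicate ⌈ proj₂ e / wbar D ⌉ℕ (proj₁ e)) (entries D)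

  data Change (D D' : Dist) (i : ℕ) : Set where
    reweight : ∀ rest w w' →
      entries D ↭ ((i , w) ∷ rest) → entries D' ↭ ((i , w') ∷ rest) → Change D D' i
    insert   : ∀ w → i ∉ map proj₁ (entries D) →
      entries D' ↭ ((i , w) ∷ entries D) → Change D D' i
    remove   : ∀ w → entries D ↭ ((i , w) ∷ entries D') → Change D D' i

  -- The loop "insert or erase occurrences of i in P until its count equals
  -- the target" (at arbitrary positions).
  data Adjust (i target : ℕ) : Array → Array → Set where
    done  : ∀ {P} → count i P ≡ target → Adjust i target P P
    ins   : ∀ {Q} xs ys → count i (xs ++ ys) ℕ.< target →
            Adjust i target (xs ++ i ∷ ys) Q → Adjust i target (xs ++ ys) Q
    erase : ∀ {Q} xs ys → target ℕ.< count i (xs ++ i ∷ ys) →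
            Adjust i target (xs ++ ys) Q → Adjust i target (xs ++ i ∷ ys) Q

  target : (i : ℕ) → (Dnew Dref : Dist) → ℕ
  target i Dnew Dref with weightOf i (entries Dnew)
  ... | just w  = ⌈ w / wbar Dref ⌉ℕ
  ... | nothing = 0

  -- One step of Update at step t+1: given the distribution sequence D,
  -- the index i affected by the change from step t to t+1, the old state
  -- (r, P) = (r^(t), P^(t)) and the new state (r', P') = (r^(t+1), P^(t+1)).
  data UpdateStep (D : ℕ → Dist) (t i : ℕ) : (ℕ × Array) → (ℕ × Array) → Set where
    rebuild : ∀ {r P} →
      (wbar (D (suc t)) < wbar (D r) / fromℕ 2 ⊎ fromℕ 2 * wbar (D r) < wbar (D (suc t))) →
      UpdateStep D t i (r , P) (suc t , construct (D (suc t)))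
    adjust  : ∀ {r P P'} →
      wbar (D r) / fromℕ 2 ≤ wbar (D (suc t)) → wbar (D (suc t)) ≤ fromℕ 2 * wbar (D r) →
      Adjust i (target i (D (suc t)) (D r)) P P' →
      UpdateStep D t i (r , P) (r , P')

{-# OPTIONS --safe #-}
-- Since the last rebuild at step r, the array contains every index of the
-- current distribution exactly ⌈ w / w̄⁽ʳ⁾ ⌉ times and no other index: Construct
-- establishes this, and Update only touches the count of the changed index.
-- Moreover w̄⁽ʳ⁾ and w̄⁽ᵗ⁾ are within a factor 2 of each other, since otherwise
-- Update rebuilds.  Hence w / w̄⁽ʳ⁾ lies between (1/2)·w / w̄⁽ᵗ⁾ and 2·w / w̄⁽ᵗ⁾,
-- and rounding up gives 2-suitability; right after Construct, r = t and the
-- same sandwich with factor 1 gives 1-suitability.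
module Submission where

open import Defs
open import Level using (0ℓ)
open import Data.Nat as ℕ using (ℕ; zero; suc; z≤n; s≤s)
import Data.Nat.Properties as ℕ
open import Data.Integer using (+_; -[1+_])
open import Data.Product using (_×_; _,_; proj₁; proj₂)
open import Data.Sum using (inj₁; inj₂)
open import Data.Empty using (⊥-elim)
open import Data.Maybe using (just; nothing; maybe′)
open import Data.Maybe.Properties using (just-injective)
open import Function using (_∘_)
open import Data.List using (List; []; _∷_; _++_; map; length; replicate; concatMap)
open import Data.List.Relation.Unary.All using (All; []; _∷_)
import Data.List.Relation.Unary.All as All
open import Data.List.Relation.Unary.All.Properties using (All¬⇒¬Any)
open import Data.List.Relation.Unary.Any using (here; there)
open import Data.List.Relation.Unary.AllPairs using (_∷_)
open import Data.List.Relation.Unary.Unique.Propositional using (Unique)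
open import Data.List.Membership.Propositional using (_∈_; _∉_)
open import Data.List.Membership.Propositional.Properties using (∈-map⁺)
open import Data.List.Relation.Binary.Permutation.Propositional using (_↭_; ↭-sym)
open import Data.List.Relation.Binary.Permutation.Propositional.Properties using (∈-resp-↭)
import Data.List.Relation.Binary.Permutation.Propositional.Properties as ↭
open import Relation.Nullary using (¬_; yes; no)
open import Relation.Binary.PropositionalEquality
open import Relation.Binary.Bundles using (StrictPartialOrder)
open import Relation.Binary.Structures using (IsStrictTotalOrder)
open import Relation.Binary.Definitions using (tri<; tri≈; tri>)
open import Algebra.Bundles using (CommutativeRing)
import Algebra.Properties.Ring as RingProperties
import Algebra.Solver.CommutativeMonoid as CommutativeMonoidSolver
import Relation.Binary.Reasoning.StrictPartialOrder as StrictPartialOrderReasoning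

module OrderedFieldProperties (F : OrderedField) where
  open OrderedField F

  commutativeRing : CommutativeRing 0ℓ 0ℓ
  commutativeRing = record { isCommutativeRing = isCommutativeRing }

  open CommutativeRing commutativeRing
    using (+-comm; +-identityˡ; +-identityʳ; *-identityˡ; -‿inverseˡ; -‿inverseʳ;
           +-assoc; distribˡ; distribʳ; zeroʳ; *-commutativeMonoid; ring)
  open RingProperties ring using (-‿distribʳ-*; -1*x≈-x; -‿involutive)
  open IsStrictTotalOrder isStrictTotalOrder using (irrefl; asym; compare; isStrictPartialOrder)
  open CommutativeMonoidSolver *-commutativeMonoid using (solve; _⊜_; _⊕_)

  strictPartialOrder : StrictPartialOrder 0ℓ 0ℓ 0ℓ
  strictPartialOrder = record { isStrictPartialOrder = isStrictPartialOrder }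

  module ≤-Reasoning = StrictPartialOrderReasoning strictPartialOrder

  <-irrefl : ∀ {x} → ¬ (x < x)
  <-irrefl = irrefl refl

  ≤-trans : ∀ {x y z} → x ≤ y → y ≤ z → x ≤ z
  ≤-trans {x} {y} {z} p q = begin x ≤⟨ p ⟩ y ≤⟨ q ⟩ z ∎
    where open ≤-Reasoning

  +-monoˡ-≤ : ∀ {x y} z → x ≤ y → x + z ≤ y + z
  +-monoˡ-≤ z (inj₁ x<y) = inj₁ (+-mono-< z x<y)
  +-monoˡ-≤ z (inj₂ refl) = inj₂ refl

  <-≤-asym : ∀ {x y} → x < y → ¬ (y ≤ x)
  <-≤-asym {x} {y} x<y y≤x = <-irrefl (begin-strict x <⟨ x<y ⟩ y ≤⟨ y≤x ⟩ x ∎)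
    where open ≤-Reasoning

  +-monoʳ-≤ : ∀ {x y} z → x ≤ y → z + x ≤ z + y
  +-monoʳ-≤ {x} {y} z x≤y = subst₂ _≤_ (+-comm x z) (+-comm y z) (+-monoˡ-≤ z x≤y)

  x<0⇒0<-x : ∀ {x} → x < 0# → 0# < - x
  x<0⇒0<-x {x} x<0 = subst₂ _<_ (-‿inverseʳ x) (+-identityˡ (- x)) (+-mono-< (- x) x<0)

  0<x⇒-x<0 : ∀ {x} → 0# < x → - x < 0#
  0<x⇒-x<0 {x} 0<x = subst₂ _<_ (+-identityˡ (- x)) (-‿inverseʳ x) (+-mono-< (- x) 0<x)

  0<1 : 0# < 1#
  0<1 with compare 0# 1#
  ... | tri< 0<1 _ _ = 0<1
  ... | tri≈ _ 0≡1 _ = ⊥-elim (0≢1 0≡1)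
  ... | tri> _ _ 1<0 = ⊥-elim (asym 1<0 (subst (0# <_) -1*-1≡1 (*-pos 0<-1 0<-1)))
    where
    0<-1 = x<0⇒0<-x 1<0
    -1*-1≡1 : - 1# * - 1# ≡ 1#
    -1*-1≡1 = trans (-1*x≈-x (- 1#)) (-‿involutive 1#)

  0<x⇒x≢0 : ∀ {x} → 0# < x → x ≢ 0#
  0<x⇒x≢0 0<x x≡0 = irrefl (sym x≡0) 0<x

  x*x⁻¹≡1 : ∀ {x} → 0# < x → x * x ⁻¹ ≡ 1#
  x*x⁻¹≡1 {x} 0<x = ⁻¹-inverse x (0<x⇒x≢0 0<x)

  ⁻¹-pos : ∀ {x} → 0# < x → 0# < x ⁻¹
  ⁻¹-pos {x} 0<x with compare 0# (x ⁻¹)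
  ... | tri< 0<x⁻¹ _ _ = 0<x⁻¹
  ... | tri≈ _ 0≡x⁻¹ _ = ⊥-elim (0≢1 (begin
        0#        ≡⟨ sym (zeroʳ x) ⟩
        x * 0#    ≡⟨ cong (x *_) 0≡x⁻¹ ⟩
        x * x ⁻¹  ≡⟨ x*x⁻¹≡1 0<x ⟩
        1#        ∎))
    where open ≡-Reasoning
  ... | tri> _ _ x⁻¹<0 =
    ⊥-elim (asym (0<x⇒-x<0 0<1) (subst (0# <_) x*-x⁻¹≡-1 (*-pos 0<x (x<0⇒0<-x x⁻¹<0))))
    where
    x*-x⁻¹≡-1 : x * - (x ⁻¹) ≡ - 1#
    x*-x⁻¹≡-1 = trans (sym (-‿distribʳ-* x (x ⁻¹))) (cong -_ (x*x⁻¹≡1 0<x))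

  0<x∧0≤y⇒0<x+y : ∀ {x y} → 0# < x → 0# ≤ y → 0# < x + y
  0<x∧0≤y⇒0<x+y {x} {y} 0<x 0≤y = begin-strict
    0#      ≤⟨ 0≤y ⟩
    y       ≡⟨ +-identityˡ y ⟨
    0# + y  <⟨ +-mono-< y 0<x ⟩
    x + y   ∎
    where open ≤-Reasoning

  *-monoˡ-< : ∀ {c x y} → 0# < c → x < y → c * x < c * y
  *-monoˡ-< {c} {x} {y} 0<c x<y = begin-strict
    c * x                      ≡⟨ +-identityˡ (c * x) ⟨
    0# + c * x                 <⟨ +-mono-< (c * x) 0<c[y-x] ⟩
    c * y + - (c * x) + c * x  ≡⟨ +-assoc (c * y) (- (c * x)) (c * x) ⟩
    c * y + (- (c * x) + c * x) ≡⟨ cong (_+_ (c * y)) (-‿inverseˡ (c * x)) ⟩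
    c * y + 0#                 ≡⟨ +-identityʳ (c * y) ⟩
    c * y                      ∎
    where
    open ≤-Reasoning
    0<y-x : 0# < y + - x
    0<y-x = subst (_< y + - x) (-‿inverseʳ x) (+-mono-< (- x) x<y)
    0<c[y-x] : 0# < c * y + - (c * x)
    0<c[y-x] = subst (0# <_) (trans (distribˡ c y (- x)) (cong (_+_ (c * y)) (sym (-‿distribʳ-* c x))))
                     (*-pos 0<c 0<y-x)

  *-monoˡ-≤ : ∀ {c x y} → 0# < c → x ≤ y → c * x ≤ c * y
  *-monoˡ-≤ 0<c (inj₁ x<y) = inj₁ (*-monoˡ-< 0<c x<y)
  *-monoˡ-≤ 0<c (inj₂ refl) = inj₂ refl

  fromℕ-nonneg : ∀ m → 0# ≤ fromℕ m
  fromℕ-nonneg zero    = inj₂ refl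
  fromℕ-nonneg (suc m) = inj₁ (0<x∧0≤y⇒0<x+y 0<1 (fromℕ-nonneg m))

  fromℕ-pos : ∀ m → 0# < fromℕ (suc m)
  fromℕ-pos m = 0<x∧0≤y⇒0<x+y 0<1 (fromℕ-nonneg m)

  fromℕ-mono-≤ : ∀ {m n} → m ℕ.≤ n → fromℕ m ≤ fromℕ n
  fromℕ-mono-≤ {n = n} z≤n = fromℕ-nonneg n
  fromℕ-mono-≤ (s≤s m≤n)   = +-monoʳ-≤ 1# (fromℕ-mono-≤ m≤n)

  fromℕ-cancel-< : ∀ {m n} → fromℕ m < fromℕ (suc n) → m ℕ.≤ n
  fromℕ-cancel-< {m} {n} m<1+n with m ℕ.≤? n
  ... | yes m≤n = m≤n
  ... | no m≰n  = ⊥-elim (<-≤-asym m<1+n (fromℕ-mono-≤ (ℕ.≰⇒> m≰n)))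

  fromℕ-1 : fromℕ 1 ≡ 1#
  fromℕ-1 = +-identityʳ 1#

  2*x≡x+x : ∀ x → fromℕ 2 * x ≡ x + x
  2*x≡x+x x = begin
    (1# + (1# + 0#)) * x    ≡⟨ distribʳ x 1# (1# + 0#) ⟩
    1# * x + (1# + 0#) * x  ≡⟨ cong₂ (λ a b → a + b * x) (*-identityˡ x) fromℕ-1 ⟩
    x + 1# * x              ≡⟨ cong (_+_ x) (*-identityˡ x) ⟩
    x + x                   ∎
    where open ≡-Reasoning

  x≤2*x : ∀ {x} → 0# < x → x ≤ fromℕ 2 * x
  x≤2*x {x} 0<x = inj₁ (begin-strict
    x           ≡⟨ +-identityˡ x ⟨
    0# + x      <⟨ +-mono-< x 0<x ⟩
    x + x       ≡⟨ 2*x≡x+x x ⟨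
    fromℕ 2 * x ∎)
    where open ≤-Reasoning

  [x*x⁻¹]*y≡y : ∀ {x} y → 0# < x → x * x ⁻¹ * y ≡ y
  [x*x⁻¹]*y≡y {x} y 0<x = trans (cong (_* y) (x*x⁻¹≡1 0<x)) (*-identityˡ y)

  x⁻¹*[x*y]≡y : ∀ {x} y → 0# < x → x ⁻¹ * (x * y) ≡ y
  x⁻¹*[x*y]≡y {x} y 0<x =
    trans (solve 3 (λ x x⁻¹ y → x⁻¹ ⊕ (x ⊕ y) ⊜ (x ⊕ x⁻¹) ⊕ y) refl x (x ⁻¹) y) ([x*x⁻¹]*y≡y y 0<x)

  1⁻¹≡1 : 1# ⁻¹ ≡ 1#
  1⁻¹≡1 = trans (sym (*-identityˡ (1# ⁻¹))) (x*x⁻¹≡1 0<1)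

  fromℕ-1*x≡x : ∀ x → fromℕ 1 * x ≡ x
  fromℕ-1*x≡x x = trans (cong (_* x) fromℕ-1) (*-identityˡ x)

  fromℕ-1⁻¹*x≡x : ∀ x → fromℕ 1 ⁻¹ * x ≡ x
  fromℕ-1⁻¹*x≡x x = trans (cong (λ c → c ⁻¹ * x) fromℕ-1) (trans (cong (_* x) 1⁻¹≡1) (*-identityˡ x))

  x/2≤y⇒x≤2*y : ∀ {x y} → x / fromℕ 2 ≤ y → x ≤ fromℕ 2 * y
  x/2≤y⇒x≤2*y {x} {y} x/2≤y = subst (_≤ fromℕ 2 * y) 2*[x/2]≡x (*-monoˡ-≤ (fromℕ-pos 1) x/2≤y)
    where
    2*[x/2]≡x : fromℕ 2 * (x / fromℕ 2) ≡ x
    2*[x/2]≡x = trans (solve 3 (λ t x t⁻¹ → t ⊕ (x ⊕ t⁻¹) ⊜ (t ⊕ t⁻¹) ⊕ x) refl (fromℕ 2) x (fromℕ 2 ⁻¹))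
                      ([x*x⁻¹]*y≡y x (fromℕ-pos 1))

  b≤c*a⇒w/a≤c*[w/b] : ∀ {w a b c} → 0# < w → 0# < a → 0# < b → b ≤ c * a → w / a ≤ c * (w / b)
  b≤c*a⇒w/a≤c*[w/b] {w} {a} {b} {c} 0<w 0<a 0<b b≤c*a = begin
    w * a ⁻¹                    ≡⟨ [x*x⁻¹]*y≡y (w * a ⁻¹) 0<b ⟨
    b * b ⁻¹ * (w * a ⁻¹)       ≡⟨ solve 4 (λ w a⁻¹ b⁻¹ b → (b ⊕ b⁻¹) ⊕ (w ⊕ a⁻¹) ⊜ (w ⊕ (a⁻¹ ⊕ b⁻¹)) ⊕ b)
                                           refl w (a ⁻¹) (b ⁻¹) b ⟩
    k * b                       ≤⟨ *-monoˡ-≤ 0<k b≤c*a ⟩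
    k * (c * a)                 ≡⟨ solve 5 (λ w a⁻¹ b⁻¹ c a → (w ⊕ (a⁻¹ ⊕ b⁻¹)) ⊕ (c ⊕ a) ⊜ (a ⊕ a⁻¹) ⊕ (c ⊕ (w ⊕ b⁻¹)))
                                           refl w (a ⁻¹) (b ⁻¹) c a ⟩
    a * a ⁻¹ * (c * (w * b ⁻¹)) ≡⟨ [x*x⁻¹]*y≡y (c * (w * b ⁻¹)) 0<a ⟩
    c * (w * b ⁻¹)              ∎
    where
    open ≤-Reasoning
    k = w * (a ⁻¹ * b ⁻¹)
    0<k : 0# < k
    0<k = *-pos 0<w (*-pos (⁻¹-pos 0<a) (⁻¹-pos 0<b))

  x≤c*y⇒c⁻¹*x≤y : ∀ {c x y} → 0# < c → x ≤ c * y → c ⁻¹ * x ≤ y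
  x≤c*y⇒c⁻¹*x≤y {c} {x} {y} 0<c x≤c*y =
    subst (c ⁻¹ * x ≤_) (x⁻¹*[x*y]≡y y 0<c) (*-monoˡ-≤ (⁻¹-pos 0<c) x≤c*y)

module CeilFieldProperties (K : CeilField) where
  open Model K
  open OrderedFieldProperties orderedField
  open CommutativeRing commutativeRing using (+-comm)

  ⌈⌉≡⌈⌉ℕ : ∀ {x} → 0# < x → fromℤ ⌈ x ⌉ ≡ fromℕ ⌈ x ⌉ℕ
  ⌈⌉≡⌈⌉ℕ {x} 0<x with ⌈ x ⌉ | ceil-upper x
  ... | + _      | _ = refl
  ... | -[1+ m ] | x≤⌈x⌉ =
    ⊥-elim (<-≤-asym (0<x⇒-x<0 (fromℕ-pos m)) (≤-trans (inj₁ 0<x) x≤⌈x⌉))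

  ⌈⌉ℕ-upper : ∀ {x} → 0# < x → x ≤ fromℕ ⌈ x ⌉ℕ
  ⌈⌉ℕ-upper {x} 0<x = subst (x ≤_) (⌈⌉≡⌈⌉ℕ 0<x) (ceil-upper x)

  ⌈⌉ℕ-mono-≤ : ∀ {x y} → 0# < x → x ≤ y → ⌈ x ⌉ℕ ℕ.≤ ⌈ y ⌉ℕ
  ⌈⌉ℕ-mono-≤ {x} {y} 0<x x≤y = fromℕ-cancel-< (begin-strict
    fromℕ ⌈ x ⌉ℕ       ≡⟨ ⌈⌉≡⌈⌉ℕ 0<x ⟨
    fromℤ ⌈ x ⌉        <⟨ ceil-lower x ⟩
    x + 1#             ≤⟨ +-monoˡ-≤ 1# (≤-trans x≤y (⌈⌉ℕ-upper 0<y)) ⟩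
    fromℕ ⌈ y ⌉ℕ + 1#  ≡⟨ +-comm (fromℕ ⌈ y ⌉ℕ) 1# ⟩
    fromℕ (suc ⌈ y ⌉ℕ) ∎)
    where
    open ≤-Reasoning
    0<y : 0# < y
    0<y = begin-strict 0# <⟨ 0<x ⟩ x ≤⟨ x≤y ⟩ y ∎

module CountProperties (K : CeilField) where
  open Model K

  count-cons-≡ : ∀ j xs → count j (j ∷ xs) ≡ suc (count j xs)
  count-cons-≡ j xs with j ℕ.≟ j
  ... | yes _  = refl
  ... | no j≢j = ⊥-elim (j≢j refl)

  count-cons-≢ : ∀ {i j} xs → i ≢ j → count j (i ∷ xs) ≡ count j xs
  count-cons-≢ {i} {j} xs i≢j with i ℕ.≟ j
  ... | yes i≡j = ⊥-elim (i≢j i≡j)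
  ... | no _    = refl

  count-++ : ∀ j xs ys → count j (xs ++ ys) ≡ count j xs ℕ.+ count j ys
  count-++ j []       ys = refl
  count-++ j (x ∷ xs) ys with x ℕ.≟ j
  ... | yes _ = cong suc (count-++ j xs ys)
  ... | no _  = count-++ j xs ys

  count-replicate-≡ : ∀ j k → count j (replicate k j) ≡ k
  count-replicate-≡ j zero    = refl
  count-replicate-≡ j (suc k) = trans (count-cons-≡ j (replicate k j)) (cong suc (count-replicate-≡ j k))

  count-replicate-≢ : ∀ {i j} k → i ≢ j → count j (replicate k i) ≡ 0
  count-replicate-≢ zero    i≢j = refl
  count-replicate-≢ (suc k) i≢j = trans (count-cons-≢ (replicate k _) i≢j) (count-replicate-≢ k i≢j)

  count-insert-≢ : ∀ {i j} xs ys → i ≢ j → count j (xs ++ i ∷ ys) ≡ count j (xs ++ ys)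
  count-insert-≢ {i} {j} xs ys i≢j = begin
    count j (xs ++ i ∷ ys)             ≡⟨ count-++ j xs (i ∷ ys) ⟩
    count j xs ℕ.+ count j (i ∷ ys)    ≡⟨ cong (count j xs ℕ.+_) (count-cons-≢ ys i≢j) ⟩
    count j xs ℕ.+ count j ys          ≡⟨ count-++ j xs ys ⟨
    count j (xs ++ ys)                 ∎
    where open ≡-Reasoning

  Adjust⇒count≡target : ∀ {i k P Q} → Adjust i k P Q → count i Q ≡ k
  Adjust⇒count≡target (done i≡k)       = i≡k
  Adjust⇒count≡target (ins _ _ _ a)    = Adjust⇒count≡target a
  Adjust⇒count≡target (erase _ _ _ a)  = Adjust⇒count≡target a

  Adjust⇒count-≢ : ∀ {i k P Q j} → Adjust i k P Q → i ≢ j → count j Q ≡ count j P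
  Adjust⇒count-≢ (done _)            i≢j = refl
  Adjust⇒count-≢ (ins xs ys _ a)     i≢j = trans (Adjust⇒count-≢ a i≢j) (count-insert-≢ xs ys i≢j)
  Adjust⇒count-≢ (erase xs ys _ a)   i≢j = trans (Adjust⇒count-≢ a i≢j) (sym (count-insert-≢ xs ys i≢j))

module DistributionProperties (K : CeilField) where
  open Model K
  open OrderedFieldProperties orderedField
  open CountProperties K

  keys : List (ℕ × Carrier) → List ℕ
  keys = map proj₁

  weightOf-skip : ∀ {i j w} es → i ≢ j → weightOf j ((i , w) ∷ es) ≡ weightOf j es
  weightOf-skip {i} {j} es i≢j with i ℕ.≟ j
  ... | yes i≡j = ⊥-elim (i≢j i≡j)
  ... | no _    = refl

  weightOf-∉ : ∀ {j} es → j ∉ keys es → weightOf j es ≡ nothing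
  weightOf-∉ []             _   = refl
  weightOf-∉ ((i , w) ∷ es) j∉ =
    trans (weightOf-skip es (λ i≡j → j∉ (here (sym i≡j)))) (weightOf-∉ es (j∉ ∘ there))

  weightOf-∈ : ∀ {j w} es → Unique (keys es) → (j , w) ∈ es → weightOf j es ≡ just w
  weightOf-∈ ((i , _) ∷ es) _ (here refl) with i ℕ.≟ i
  ... | yes _  = refl
  ... | no i≢i = ⊥-elim (i≢i refl)
  weightOf-∈ {j} ((i , _) ∷ es) (i∉es ∷ uniq) (there j∈es) =
    trans (weightOf-skip es i≢j) (weightOf-∈ es uniq j∈es)
    where
    i≢j : i ≢ j
    i≢j refl = All¬⇒¬Any i∉es (∈-map⁺ proj₁ j∈es)

  weightOf-just⇒∈ : ∀ {j w} es → weightOf j es ≡ just w → (j , w) ∈ es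
  weightOf-just⇒∈ {j} ((i , u) ∷ es) eq with i ℕ.≟ j
  ... | yes refl = here (cong (i ,_) (sym (just-injective eq)))
  ... | no _     = there (weightOf-just⇒∈ es eq)

  weightOf-nothing⇒∉ : ∀ {j} es → weightOf j es ≡ nothing → j ∉ keys es
  weightOf-nothing⇒∉ {j} ((i , _) ∷ es) eq j∈ with i ℕ.≟ j | eq | j∈
  ... | yes _   | ()  | _
  ... | no i≢j  | _   | here j≡i   = i≢j (sym j≡i)
  ... | no _    | eq′ | there j∈es = weightOf-nothing⇒∉ es eq′ j∈es

  weightOf-resp-↭ : ∀ {j es fs} → Unique (keys es) → es ↭ fs → weightOf j es ≡ weightOf j fs
  weightOf-resp-↭ {j} {es} {fs} uniq es↭fs with weightOf j fs in eq
  ... | just w  = weightOf-∈ es uniq (∈-resp-↭ (↭-sym es↭fs) (weightOf-just⇒∈ fs eq))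
  ... | nothing = weightOf-∉ es (weightOf-nothing⇒∉ fs eq ∘ ∈-resp-↭ (↭.map⁺ proj₁ es↭fs))

  Change⇒weightOf-≢ : ∀ {D D′ i j} → Change D D′ i → i ≢ j →
                      weightOf j (entries D′) ≡ weightOf j (entries D)
  Change⇒weightOf-≢ {D} {D′} {i} {j} (reweight rest w w′ D↭ D′↭) i≢j = begin
    weightOf j (entries D′)      ≡⟨ weightOf-resp-↭ (unique D′) D′↭ ⟩
    weightOf j ((i , w′) ∷ rest) ≡⟨ weightOf-skip rest i≢j ⟩
    weightOf j rest              ≡⟨ weightOf-skip rest i≢j ⟨
    weightOf j ((i , w) ∷ rest)  ≡⟨ weightOf-resp-↭ (unique D) D↭ ⟨
    weightOf j (entries D)       ∎
    where open ≡-Reasoning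
  Change⇒weightOf-≢ {D} {D′} (insert w _ D′↭) i≢j =
    trans (weightOf-resp-↭ (unique D′) D′↭) (weightOf-skip (entries D) i≢j)
  Change⇒weightOf-≢ {D} {D′} (remove w D↭) i≢j =
    sym (trans (weightOf-resp-↭ (unique D) D↭) (weightOf-skip (entries D′) i≢j))

  target≡maybe : ∀ j D Dref →
                 target j D Dref ≡ maybe′ (λ w → ⌈ w / wbar Dref ⌉ℕ) 0 (weightOf j (entries D))
  target≡maybe j D Dref with weightOf j (entries D)
  ... | just _  = refl
  ... | nothing = refl

  count-concatMap-replicate : ∀ (f : Carrier → ℕ) j es → Unique (keys es) →
    count j (concatMap (λ e → replicate (f (proj₂ e)) (proj₁ e)) es) ≡ maybe′ f 0 (weightOf j es)
  count-concatMap-replicate f j [] _ = refl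
  count-concatMap-replicate f j ((i , w) ∷ es) (i∉es ∷ uniq)
    rewrite count-++ j (replicate (f w) i) (concatMap (λ e → replicate (f (proj₂ e)) (proj₁ e)) es)
    with i ℕ.≟ j
  ... | yes refl = begin
        count i (replicate (f w) i) ℕ.+ _  ≡⟨ cong₂ ℕ._+_ (count-replicate-≡ i (f w))
                                                          (count-concatMap-replicate f i es uniq) ⟩
        f w ℕ.+ maybe′ f 0 (weightOf i es) ≡⟨ cong (λ m → f w ℕ.+ maybe′ f 0 m)
                                                   (weightOf-∉ es (All¬⇒¬Any i∉es)) ⟩
        f w ℕ.+ 0                          ≡⟨ ℕ.+-identityʳ (f w) ⟩
        f w                                ∎
    where open ≡-Reasoning
  ... | no i≢j = cong₂ ℕ._+_ (count-replicate-≢ (f w) i≢j) (count-concatMap-replicate f j es uniq)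

  sumW-nonneg : ∀ es → All (λ e → 0# < proj₂ e) es → 0# ≤ sumW es
  sumW-nonneg []       []         = inj₂ refl
  sumW-nonneg (_ ∷ es) (0<w ∷ ps) = inj₁ (0<x∧0≤y⇒0<x+y 0<w (sumW-nonneg es ps))

  wbar-pos : ∀ D → 0# < wbar D
  wbar-pos D with entries D | positive D | nonempty D
  ... | []     | _          | ≢[] = ⊥-elim (≢[] refl)
  ... | _ ∷ es | 0<w ∷ ps   | _   =
    *-pos (0<x∧0≤y⇒0<x+y 0<w (sumW-nonneg es ps)) (⁻¹-pos (fromℕ-pos (length es)))

module UpdateInvariant (K : CeilField) where
  open Model K
  open OrderedFieldProperties orderedField
  open CeilFieldProperties K
  open CountProperties K
  open DistributionProperties K

  Tracks : Dist → Dist → Array → Set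
  Tracks Dref D P = ∀ j → count j P ≡ target j D Dref

  Tracks⇒count≡⌈w/wbar⌉ : ∀ {Dref D P i w} → Tracks Dref D P → (i , w) ∈ entries D →
                          count i P ≡ ⌈ w / wbar Dref ⌉ℕ
  Tracks⇒count≡⌈w/wbar⌉ {Dref} {D} {i = i} tracks iw∈D = trans (tracks i)
    (trans (target≡maybe i D Dref) (cong (maybe′ _ 0) (weightOf-∈ (entries D) (unique D) iw∈D)))

  Tracks⇒Suitable : ∀ {α Dref D P} → Tracks Dref D P →
    (∀ {w} → 0# < w → α ⁻¹ * (w / wbar D) ≤ w / wbar Dref × w / wbar Dref ≤ α * (w / wbar D)) →
    Suitable α P D
  Tracks⇒Suitable {α} {Dref} {D} {P} tracks bounds i w iw∈D =
    subst (λ c → α ⁻¹ * (w / wbar D) ≤ fromℕ c × c ℕ.≤ ⌈ α * (w / wbar D) ⌉ℕ)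
          (sym (Tracks⇒count≡⌈w/wbar⌉ {Dref} {D} {P} tracks iw∈D))
          ( ≤-trans (proj₁ (bounds 0<w)) (⌈⌉ℕ-upper 0<w/wbar)
          , ⌈⌉ℕ-mono-≤ 0<w/wbar (proj₂ (bounds 0<w)))
    where
    0<w : 0# < w
    0<w = All.lookup (positive D) iw∈D
    0<w/wbar : 0# < w / wbar Dref
    0<w/wbar = *-pos 0<w (⁻¹-pos (wbar-pos Dref))

  Tracks-construct : ∀ D → Tracks D D (construct D)
  Tracks-construct D j =
    trans (count-concatMap-replicate _ j (entries D) (unique D)) (sym (target≡maybe j D D))

  Tracks-adjust : ∀ {Dref D D′ i P P′} → Change D D′ i → Tracks Dref D P →
                  Adjust i (target i D′ Dref) P P′ → Tracks Dref D′ P′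
  Tracks-adjust {Dref} {D} {D′} {i} {P} {P′} change tracks adj j with i ℕ.≟ j
  ... | yes refl = Adjust⇒count≡target adj
  ... | no i≢j   = begin
    count j P′                                 ≡⟨ Adjust⇒count-≢ adj i≢j ⟩
    count j P                                  ≡⟨ tracks j ⟩
    target j D Dref                            ≡⟨ target≡maybe j D Dref ⟩
    maybe′ ⌈/wbar⌉ 0 (weightOf j (entries D))  ≡⟨ cong (maybe′ ⌈/wbar⌉ 0) (Change⇒weightOf-≢ change i≢j) ⟨
    maybe′ ⌈/wbar⌉ 0 (weightOf j (entries D′)) ≡⟨ target≡maybe j D′ Dref ⟨
    target j D′ Dref                           ∎
    where
    open ≡-Reasoning
    ⌈/wbar⌉ : Carrier → ℕ
    ⌈/wbar⌉ w = ⌈ w / wbar Dref ⌉ℕ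

  record Invariant (Dref D : Dist) (P : Array) : Set where
    field
      tracks    : Tracks Dref D P
      ref≤2*cur : wbar Dref ≤ fromℕ 2 * wbar D
      cur≤2*ref : wbar D ≤ fromℕ 2 * wbar Dref

  open Invariant

  Invariant-construct : ∀ D → Invariant D D (construct D)
  Invariant-construct D = record
    { tracks    = Tracks-construct D
    ; ref≤2*cur = x≤2*x (wbar-pos D)
    ; cur≤2*ref = x≤2*x (wbar-pos D)
    }

  Invariant-step : ∀ {D t i r P r′ P′} → Change (D t) (D (suc t)) i →
                   UpdateStep D t i (r , P) (r′ , P′) →
                   Invariant (D r) (D t) P → Invariant (D r′) (D (suc t)) P′
  Invariant-step {D} {t} _ (rebuild _) _ = Invariant-construct (D (suc t))
  Invariant-step change (adjust ref/2≤new new≤2*ref adj) inv = record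
    { tracks    = Tracks-adjust change (tracks inv) adj
    ; ref≤2*cur = x/2≤y⇒x≤2*y ref/2≤new
    ; cur≤2*ref = new≤2*ref
    }

  Invariant⇒Suitable-2 : ∀ {Dref D P} → Invariant Dref D P → Suitable (fromℕ 2) P D
  Invariant⇒Suitable-2 {Dref} {D} {P} inv =
    Tracks⇒Suitable {fromℕ 2} {Dref} {D} {P} (tracks inv) λ 0<w →
      x≤c*y⇒c⁻¹*x≤y (fromℕ-pos 1) (b≤c*a⇒w/a≤c*[w/b] 0<w (wbar-pos D) (wbar-pos Dref) (ref≤2*cur inv))
    , b≤c*a⇒w/a≤c*[w/b] 0<w (wbar-pos Dref) (wbar-pos D) (cur≤2*ref inv)

  construct-Suitable-1 : ∀ D → Suitable (fromℕ 1) (construct D) D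
  construct-Suitable-1 D =
    Tracks⇒Suitable {fromℕ 1} {D} {D} {construct D} (Tracks-construct D) λ {w} _ →
      inj₂ (fromℕ-1⁻¹*x≡x (w / wbar D)) , inj₂ (sym (fromℕ-1*x≡x (w / wbar D)))

lemma4p2 : (K : CeilField) → let open Model K in
    (D : ℕ → Dist) (idx : ℕ → ℕ) →
    (∀ t → Change (D t) (D (suc t)) (idx t)) →
    (r : ℕ → ℕ) (P : ℕ → Array) →
    r 0 ≡ 0 → P 0 ≡ construct (D 0) →
    (∀ t → UpdateStep D t (idx t) (r t , P t) (r (suc t) , P (suc t))) →
    Suitable (fromℕ 1) (P 0) (D 0) × (∀ t → Suitable (fromℕ 2) (P t) (D t))
lemma4p2 K D idx change r P r₀≡0 P₀≡construct update =
    subst (λ P₀ → Suitable (fromℕ 1) P₀ (D 0)) (sym P₀≡construct) (construct-Suitable-1 (D 0))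
  , λ t → Invariant⇒Suitable-2 (invariant t)
  where
  open Model K
  open UpdateInvariant K

  invariant : ∀ t → Invariant (D (r t)) (D t) (P t)
  invariant zero    = subst₂ (λ r₀ P₀ → Invariant (D r₀) (D 0) P₀) (sym r₀≡0) (sym P₀≡construct)
                             (Invariant-construct (D 0))
  invariant (suc t) = Invariant-step (change t) (update t) (invariant t)
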